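{- Let $n\ge2$ be an integer. Every Catalan--Stanley tree $\tau$ of size $n$ satisfies $1\le\alpha(\tau)\le\lfloor n/2\rfloor$, and both bounds are attained: there exist Catalan--Stanley trees $\tau,\tau'$ of size $n$ with $\alpha(\tau)=1$ and $\alpha(\tau')=\lfloor n/2\rfloor$. The only tree of size $1$ is the one-node tree, and its age is $0$.
   Context: A rooted plane tree has ordered children at every node; its size is its number of nodes. For each child $c$ of the root, the rightmost leaf of the branch at $c$ is the leaf reached from $c$ by repeatedly moving to the rightmost child. A Catalan--Stanley tree is a rooted plane tree in which every such rightmost leaf has odd distance to the root (the one-node tree is included). The reduction $\rho$: for each rightmost leaf $\ell$ of a branch attached to the root, if $\ell$ is a child of the root it is deleted; otherwise all descendants of the grandparent of $\ell$ are deleted (the grandparent becomes a leaf); the one-node tree is mapped to itself. The age $\alpha(\tau)$ is the least $r\ge0$ such that $\rho^{r}(\tau)$ is the one-node tree. -}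

module Defs where

open import Data.Bool using (Bool; true; false; if_then_else_)
open import Data.Nat using (ℕ; zero; suc; _+_; _*_; _<_)
open import Data.List using (List; []; _∷_; _++_)
open import Data.List.Relation.Unary.All using (All)
open import Data.Product using (∃; _×_)
open import Relation.Binary.PropositionalEquality using (_≡_; _≢_)

-- Rooted plane trees: a node with an ordered list of children.
data Tree : Set where
  node : List Tree → Tree

leaf : Tree
leaf = node []

mutual
  size : Tree → ℕ
  size (node cs) = suc (sizeL cs)

  sizeL : List Tree → ℕ
  sizeL []       = 0
  sizeL (c ∷ cs) = size c + sizeL cs

-- rmDepth t = distance from t to the leaf reached from t by repeatedly
-- moving to the rightmost child.
mutual
  rmDepth : Tree → ℕ
  rmDepth (node [])       = 0
  rmDepth (node (c ∷ cs)) = suc (rmDepthL c cs)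

  -- rightmost depth of the last element of the nonempty list c ∷ cs
  rmDepthL : Tree → List Tree → ℕ
  rmDepthL c []       = rmDepth c
  rmDepthL c (d ∷ ds) = rmDepthL d ds

Odd : ℕ → Set
Odd d = ∃ λ k → d ≡ suc (2 * k)

-- Catalan–Stanley: for every child c of the root, the rightmost leaf of the
-- branch at c has odd distance to the root, i.e. 1 + rmDepth c is odd.
CatalanStanley : Tree → Set
CatalanStanley (node cs) = All (λ c → Odd (suc (rmDepth c))) cs

-- trim t: assuming the rightmost leaf of t is at distance ≥ 2 from t,
-- delete all descendants of the grandparent of that rightmost leaf.
mutual
  trim : Tree → Tree
  trim (node [])       = node []
  trim (node (c ∷ cs)) with rmDepthL c cs
  ... | 1 = node []   -- t itself is the grandparent of its rightmost leaf
  ... | _ = node (trimL c cs)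

  trimL : Tree → List Tree → List Tree
  trimL c []       = trim c ∷ []
  trimL c (d ∷ ds) = c ∷ trimL d ds

-- does some branch have its rightmost leaf at distance 2 from the root?
-- (then the grandparent is the root itself and all its descendants are
-- deleted; this never happens for Catalan–Stanley trees)
collapses : List Tree → Bool
collapses []       = false
collapses (c ∷ cs) with rmDepth c
... | 1 = true
... | _ = collapses cs

-- reduce each branch: a branch that is a leaf (rightmost leaf = child of the
-- root) is deleted; otherwise the grandparent of its rightmost leaf is cut.
reduceBranches : List Tree → List Tree
reduceBranches []              = []
reduceBranches (node [] ∷ cs)  = reduceBranches cs
reduceBranches (node (d ∷ ds) ∷ cs) = trim (node (d ∷ ds)) ∷ reduceBranches cs

ρ : Tree → Tree
ρ (node cs) = if collapses cs then node [] else node (reduceBranches cs)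

ρ^ : ℕ → Tree → Tree
ρ^ zero    t = t
ρ^ (suc r) t = ρ^ r (ρ t)

IsAge : Tree → ℕ → Set
IsAge τ r = (ρ^ r τ ≡ leaf) × (∀ s → s < r → ρ^ s τ ≢ leaf)

module Submission where

open import Defs
open import Data.Nat using (ℕ; _≤_; _/_)
open import Data.Product using (Σ; ∃; _×_)
open import Relation.Binary.PropositionalEquality using (_≡_)

open import Function using (_∘_)
open import Data.Nat using (zero; suc; _+_; _*_; _∸_; _⊔_; _<_; z≤n; s≤s; ⌊_/2⌋)
open import Data.Nat.Properties
open import Data.Nat.DivMod using (m*n/n≡m; /-monoˡ-≤; m/n≡1+[m∸n]/n; m/n*n≤m)
open import Data.List using (List; []; _∷_; replicate)
open import Data.List.Relation.Unary.All using (All; []; _∷_)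
open import Data.List.Relation.Unary.All.Properties using (replicate⁺)
open import Data.Product using (_,_)
open import Data.Bool using (false)
open import Data.Empty using (⊥-elim)
open import Relation.Nullary using (¬_)
open import Relation.Binary.PropositionalEquality
  using (refl; sym; trans; cong; cong₂; subst; module ≡-Reasoning)

-- In a Catalan–Stanley tree every branch c (subtree at a child
-- of the root) has even rightmost depth 2k; call 1 + k the level of c, and
-- the height of a tree the largest level of its branches (0 for the
-- one-node tree).  One application of ρ deletes the branches of level 1 and
-- removes the last two edges of the rightmost path of every other branch,
-- so it keeps the tree Catalan–Stanley and lowers its height by exactly one.
-- A general iteration lemma (module AgeFromMeasure) then shows that the age
-- of a Catalan–Stanley tree is its height.  The bounds follow: a branch of
-- level 1 + k has at least 2k + 1 nodes, so 2 · height ≤ size, and a tree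
-- with a branch has height ≥ 1.  Both bounds are attained by brooms: a path
-- of length 2h hanging from the root next to j leaves, which has size
-- 2h + j + 2 and age h + 1.

-- Parity: neither 0 nor 2 is odd, which rules out rightmost depth 1 in a branch.
¬odd-zero : ¬ Odd 0
¬odd-zero (_ , ())

odd-pred₂ : ∀ {n} → Odd (2 + n) → Odd n
odd-pred₂ (zero  , ())
odd-pred₂ (suc k , e) = k , trans (suc-injective (suc-injective e)) (+-suc k (k + 0))

¬odd-two : ¬ Odd 2
¬odd-two = ¬odd-zero ∘ odd-pred₂

mutual
  trim-depth : ∀ t {k} → rmDepth t ≡ 2 + k → rmDepth (trim t) ≡ k
  trim-depth (node []) ()
  trim-depth (node (c ∷ cs)) e with rmDepthL c cs in eq | e
  ... | suc zero    | refl = refl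
  ... | suc (suc j) | refl = node-trimL-depth c cs eq

  node-trimL-depth : ∀ c cs {j} → rmDepthL c cs ≡ 2 + j →
                     rmDepth (node (trimL c cs)) ≡ suc j
  node-trimL-depth c []       e = cong suc (trim-depth c e)
  node-trimL-depth c (d ∷ ds) e = cong suc (trimL-depth d ds e)

  -- trimL applies trim to the last tree of a list, whose rightmost path
  -- is the one measured by rmDepthL.
  trimL-depth : ∀ c cs {k} → rmDepthL c cs ≡ 2 + k →
                ∀ {a} → rmDepthL a (trimL c cs) ≡ k
  trimL-depth c []       e = trim-depth c e
  trimL-depth c (d ∷ ds) e = trimL-depth d ds e

OddBranch : Tree → Set
OddBranch c = Odd (suc (rmDepth c))

level : Tree → ℕ
level c = suc ⌊ rmDepth c /2⌋

maxLevel : List Tree → ℕ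
maxLevel []       = 0
maxLevel (c ∷ cs) = level c ⊔ maxLevel cs

height : Tree → ℕ
height (node cs) = maxLevel cs

height-pos : ∀ c cs → 1 ≤ height (node (c ∷ cs))
height-pos c cs = ≤-trans (s≤s z≤n) (m≤m⊔n (level c) (maxLevel cs))

height-zero : ∀ {t} → height t ≡ 0 → t ≡ leaf
height-zero {node []}       _ = refl
height-zero {node (c ∷ cs)} h = ⊥-elim (m<n⇒n≢0 (height-pos c cs) h)

-- An odd branch that is not a leaf has rightmost depth at least two, since
-- depth one is excluded by parity.
odd-branch-deep : ∀ d ds → OddBranch (node (d ∷ ds)) → ∃ λ k → rmDepthL d ds ≡ suc k
odd-branch-deep d ds o with rmDepthL d ds | o
... | zero  | o′ = ⊥-elim (¬odd-two o′)
... | suc k | _  = k , refl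

trim-branch-depth : ∀ d ds → OddBranch (node (d ∷ ds)) →
                    rmDepth (node (d ∷ ds)) ≡ 2 + rmDepth (trim (node (d ∷ ds)))
trim-branch-depth d ds o with k , deep ← odd-branch-deep d ds o =
  trans (cong suc deep) (cong (2 +_) (sym (trim-depth (node (d ∷ ds)) (cong suc deep))))

trim-odd : ∀ d ds → OddBranch (node (d ∷ ds)) → OddBranch (trim (node (d ∷ ds)))
trim-odd d ds o = odd-pred₂ (subst (Odd ∘ suc) (trim-branch-depth d ds o) o)

trim-level : ∀ d ds → OddBranch (node (d ∷ ds)) →
             level (node (d ∷ ds)) ∸ 1 ≡ level (trim (node (d ∷ ds)))
trim-level d ds o = cong ⌊_/2⌋ (trim-branch-depth d ds o)

never-collapses : ∀ {cs} → All OddBranch cs → collapses cs ≡ false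
never-collapses [] = refl
never-collapses {c ∷ _} (o ∷ os) with rmDepth c | o
... | zero        | _  = never-collapses os
... | suc zero    | o′ = ⊥-elim (¬odd-two o′)
... | suc (suc _) | _  = never-collapses os

ρ-odd : ∀ {cs} → All OddBranch cs → ρ (node cs) ≡ node (reduceBranches cs)
ρ-odd os rewrite never-collapses os = refl

reduce-odd : ∀ {cs} → All OddBranch cs → All OddBranch (reduceBranches cs)
reduce-odd []                                = []
reduce-odd {node []       ∷ _} (_ ∷ os) = reduce-odd os
reduce-odd {node (d ∷ ds) ∷ _} (o ∷ os) = trim-odd d ds o ∷ reduce-odd os

-- Leaf branches (level 1) disappear and every other level drops by one.
reduce-maxLevel : ∀ {cs} → All OddBranch cs →
                  maxLevel (reduceBranches cs) ≡ maxLevel cs ∸ 1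
reduce-maxLevel [] = refl
reduce-maxLevel {node [] ∷ cs} (_ ∷ os) =
  trans (reduce-maxLevel os) (sym (∸-distribʳ-⊔ 1 1 (maxLevel cs)))
reduce-maxLevel {t@(node (d ∷ ds)) ∷ cs} (o ∷ os) = begin
  level (trim t) ⊔ maxLevel (reduceBranches cs)
    ≡⟨ cong₂ _⊔_ (sym (trim-level d ds o)) (reduce-maxLevel os) ⟩
  (level t ∸ 1) ⊔ (maxLevel cs ∸ 1)
    ≡⟨ sym (∸-distribʳ-⊔ 1 (level t) (maxLevel cs)) ⟩
  (level t ⊔ maxLevel cs) ∸ 1 ∎
  where open ≡-Reasoning

ρ-preserves-CS : ∀ {t} → CatalanStanley t → CatalanStanley (ρ t)
ρ-preserves-CS {node _} os = subst CatalanStanley (sym (ρ-odd os)) (reduce-odd os)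

ρ-height : ∀ {t} → CatalanStanley t → height (ρ t) ≡ height t ∸ 1
ρ-height {node _} os = trans (cong height (ρ-odd os)) (reduce-maxLevel os)

module AgeFromMeasure
  (P : Tree → Set) (μ : Tree → ℕ)
  (P-step : ∀ {t} → P t → P (ρ t))
  (μ-step : ∀ {t} → P t → μ (ρ t) ≡ μ t ∸ 1)
  (μ-zero : ∀ {t} → μ t ≡ 0 → t ≡ leaf)
  (μ-leaf : μ leaf ≡ 0)
  where

  μ-iterate : ∀ r {t} → P t → μ (ρ^ r t) ≡ μ t ∸ r
  μ-iterate zero    p = refl
  μ-iterate (suc r) {t} p = begin
    μ (ρ^ r (ρ t)) ≡⟨ μ-iterate r (P-step p) ⟩
    μ (ρ t) ∸ r    ≡⟨ cong (_∸ r) (μ-step p) ⟩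
    μ t ∸ 1 ∸ r    ≡⟨ ∸-+-assoc (μ t) 1 r ⟩
    μ t ∸ suc r    ∎
    where open ≡-Reasoning

  isAge : ∀ {t} → P t → IsAge t (μ t)
  isAge {t} p = μ-zero (trans (μ-iterate (μ t) p) (n∸n≡0 (μ t))) , earlier
    where
    earlier : ∀ s → s < μ t → ¬ (ρ^ s t ≡ leaf)
    earlier s s<μ reached = <⇒≱ s<μ (m∸n≡0⇒m≤n
      (trans (sym (μ-iterate s p)) (trans (cong μ reached) μ-leaf)))

age-height : ∀ {t} → CatalanStanley t → IsAge t (height t)
age-height = AgeFromMeasure.isAge CatalanStanley height
  ρ-preserves-CS ρ-height height-zero refl

mutual
  -- The rightmost path of a tree lies inside the tree.
  depth<size : ∀ t → rmDepth t < size t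
  depth<size (node [])       = s≤s z≤n
  depth<size (node (c ∷ cs)) = s≤s (depthL<sizeL c cs)

  depthL<sizeL : ∀ c cs → rmDepthL c cs < sizeL (c ∷ cs)
  depthL<sizeL c []       = ≤-trans (depth<size c) (m≤m+n (size c) 0)
  depthL<sizeL c (d ∷ ds) = ≤-trans (depthL<sizeL d ds) (m≤n+m (sizeL (d ∷ ds)) (size c))

-- A branch of level 1 + k has rightmost depth ≥ 2k, hence ≥ 2k + 1 nodes;
-- summing over the branch with the largest level gives 2 · height ≤ size.
double-half≤ : ∀ d → 2 * ⌊ d /2⌋ ≤ d
double-half≤ zero          = z≤n
double-half≤ (suc zero)    = z≤n
double-half≤ (suc (suc d)) =
  ≤-trans (≤-reflexive (*-suc 2 ⌊ d /2⌋)) (s≤s (s≤s (double-half≤ d)))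

level-size : ∀ c → 2 * level c ≤ suc (size c)
level-size c = ≤-trans (≤-reflexive (*-suc 2 ⌊ rmDepth c /2⌋))
  (s≤s (≤-trans (s≤s (double-half≤ (rmDepth c))) (depth<size c)))

maxLevel-size : ∀ cs → 2 * maxLevel cs ≤ suc (sizeL cs)
maxLevel-size []       = z≤n
maxLevel-size (c ∷ cs) = ≤-trans (≤-reflexive (*-distribˡ-⊔ 2 (level c) (maxLevel cs)))
  (⊔-lub (≤-trans (level-size c) (s≤s (m≤m+n (size c) (sizeL cs))))
         (≤-trans (maxLevel-size cs) (s≤s (m≤n+m (sizeL cs) (size c)))))

height-size : ∀ t → 2 * height t ≤ size t
height-size (node cs) = maxLevel-size cs

≤-half : ∀ {r n} → 2 * r ≤ n → r ≤ n / 2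
≤-half {r} {n} p =
  subst (_≤ n / 2) (m*n/n≡m r 2) (/-monoˡ-≤ 2 (subst (_≤ n) (*-comm 2 r) p))

age-bounds : ∀ k τ → CatalanStanley τ → size τ ≡ 2 + k →
             Σ ℕ (λ r → IsAge τ r × (1 ≤ r) × (r ≤ (2 + k) / 2))
age-bounds k (node [])         _    ()
age-bounds k τ@(node (c ∷ cs)) cs-τ size-τ =
  height τ , age-height cs-τ , height-pos c cs ,
  ≤-half (subst (2 * height τ ≤_) size-τ (height-size τ))

path : ℕ → Tree
path zero    = leaf
path (suc k) = node (path k ∷ [])

path-depth : ∀ k → rmDepth (path k) ≡ k
path-depth zero    = refl
path-depth (suc k) = cong suc (path-depth k)

path-size : ∀ k → size (path k) ≡ suc k
path-size zero    = refl
path-size (suc k) = cong suc (trans (+-identityʳ (size (path k))) (path-size k))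

leaves-size : ∀ j → sizeL (replicate j leaf) ≡ j
leaves-size zero    = refl
leaves-size (suc j) = cong suc (leaves-size j)

leaves-maxLevel : ∀ j → maxLevel (replicate j leaf) ≤ 1
leaves-maxLevel zero    = z≤n
leaves-maxLevel (suc j) = ⊔-lub ≤-refl (leaves-maxLevel j)

broom : ℕ → ℕ → Tree
broom h j = node (path (2 * h) ∷ replicate j leaf)

-- A broom is Catalan–Stanley, has size 2h + j + 2 and height h + 1
-- (the leaves have level 1 ≤ h + 1), hence age h + 1.
broom-CS : ∀ h j → CatalanStanley (broom h j)
broom-CS h j = (h , cong suc (path-depth (2 * h))) ∷ replicate⁺ j (0 , refl)

broom-size : ∀ h j → size (broom h j) ≡ 2 + (2 * h + j)
broom-size h j = cong suc (cong₂ _+_ (path-size (2 * h)) (leaves-size j))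

broom-height : ∀ h j → height (broom h j) ≡ suc h
broom-height h j = trans
  (m≥n⇒m⊔n≡m (≤-trans (leaves-maxLevel j) (s≤s z≤n)))
  (cong suc (begin
    ⌊ rmDepth (path (2 * h)) /2⌋ ≡⟨ cong ⌊_/2⌋ (path-depth (2 * h)) ⟩
    ⌊ h + (h + 0) /2⌋            ≡⟨ cong (λ x → ⌊ h + x /2⌋) (+-identityʳ h) ⟩
    ⌊ h + h /2⌋                  ≡⟨ sym (n≡⌊n+n/2⌋ h) ⟩
    h                            ∎))
  where open ≡-Reasoning

broom-age : ∀ h j → IsAge (broom h j) (suc h)
broom-age h j = subst (IsAge (broom h j)) (broom-height h j) (age-height (broom-CS h j))

youngest : ∀ k → ∃ λ τ → CatalanStanley τ × size τ ≡ 2 + k × IsAge τ 1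
youngest k = broom 0 k , broom-CS 0 k , broom-size 0 k , broom-age 0 k

oldest : ∀ k → ∃ λ τ → CatalanStanley τ × size τ ≡ 2 + k × IsAge τ ((2 + k) / 2)
oldest k = broom h j , broom-CS h j , size-eq ,
           subst (IsAge (broom h j)) (sym (m/n≡1+[m∸n]/n {2 + k} {2} (s≤s (s≤s z≤n))))
                 (broom-age h j)
  where
  h j : ℕ
  h = k / 2
  j = k ∸ 2 * h
  size-eq : size (broom h j) ≡ 2 + k
  size-eq = trans (broom-size h j)
    (cong (2 +_) (m+[n∸m]≡n (subst (_≤ k) (*-comm h 2) (m/n*n≤m k 2))))

size-one : (τ : Tree) → size τ ≡ 1 → τ ≡ leaf
size-one (node [])            _ = refl
size-one (node (node _ ∷ _)) ()

size-at-least-two : (n : ℕ) → 2 ≤ n →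
    ((τ : Tree) → CatalanStanley τ → size τ ≡ n →
    Σ ℕ (λ r → IsAge τ r × (1 ≤ r) × (r ≤ n / 2)))
    × (∃ λ τ → CatalanStanley τ × size τ ≡ n × IsAge τ 1)
    × (∃ λ τ′ → CatalanStanley τ′ × size τ′ ≡ n × IsAge τ′ (n / 2))
size-at-least-two (suc zero)    (s≤s ())
size-at-least-two (suc (suc k)) _ = age-bounds k , youngest k , oldest k

mainTheorem7 : ((n : ℕ) → 2 ≤ n →
    ((τ : Tree) → CatalanStanley τ → size τ ≡ n →
    Σ ℕ (λ r → IsAge τ r × (1 ≤ r) × (r ≤ n / 2)))
    × (∃ λ τ → CatalanStanley τ × size τ ≡ n × IsAge τ 1)
    × (∃ λ τ′ → CatalanStanley τ′ × size τ′ ≡ n × IsAge τ′ (n / 2)))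
    × ((τ : Tree) → size τ ≡ 1 → τ ≡ leaf)
    × IsAge leaf 0
mainTheorem7 = size-at-least-two , size-one , (refl , λ _ ())
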